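{- There exist a constant $c>0$ and, for each $n \ge 1$, a language $L_n$ accepted by a DFA with $O(n)$ states that is not suffix-free and such that every witness $(v,w)$ to the failure of suffix-freeness of $L_n$ satisfies $|w| \ge c n^2$; i.e. the smallest witness has size $\Omega(n^2)$.
   Context: A word $v$ is a suffix of $w$ if $w = xv$ for some word $x$. $L$ is suffix-free if no word of $L$ has a suffix different from itself that lies in $L$. A witness to the failure of suffix-freeness is a pair $(v,w)$ with $v,w \in L$, $v$ a suffix of $w$, $v \ne w$; its size is $|w|$. -}

module Defs where

open import Data.Nat using (ℕ)
open import Data.Fin using (Fin)
open import Data.Bool using (Bool; true)
open import Data.List using (List; _++_; foldl; length)
open import Data.Product using (∃; _×_)
open import Relation.Binary.PropositionalEquality using (_≡_)
open import Relation.Nullary using (¬_)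

Word : ℕ → Set
Word k = List (Fin k)

record DFA (k : ℕ) : Set where
  field
    states : ℕ
    start  : Fin states
    δ      : Fin states → Fin k → Fin states
    accept : Fin states → Bool

open DFA public

δ* : ∀ {k} (A : DFA k) → Fin (states A) → Word k → Fin (states A)
δ* A q w = foldl (δ A) q w

Accepts : ∀ {k} → DFA k → Word k → Set
Accepts A w = accept A (δ* A (start A) w) ≡ true

IsSuffix : ∀ {k} → Word k → Word k → Set
IsSuffix {k} v w = ∃ λ (x : Word k) → w ≡ x ++ v

-- A witness to the failure of suffix-freeness of L: v, w ∈ L,
-- v a suffix of w, v ≠ w.  Its size is |w|.
Witness : ∀ {k} → (Word k → Set) → Word k → Word k → Set
Witness L v w = L v × L w × IsSuffix v w × ¬ (v ≡ w)

SuffixFree : ∀ {k} → (Word k → Set) → Set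
SuffixFree {k} L = ∀ (v w : Word k) → ¬ Witness L v w

-- Over the alphabet {a, b, c} let Lₙ consist of the words c aˢ with s ≥ 1 and n + 1 ∣ s,
-- and b c aᵗ with n ∣ t.  Two counters modulo n + 1 and n accept Lₙ with 2n + 5 states.
-- A proper suffix of a word of Lₙ lies in Lₙ only when it is c aᵗ inside b c aᵗ, and then
-- t ≥ 1 is divisible by the coprime numbers n and n + 1, so |w| > t ≥ n (n + 1).
module Submission where

open import Defs
open import Data.Nat using (ℕ; zero; suc; _+_; _*_; _%_; _/_; _≤_; _≥_; z≤n; s≤s; NonZero; >-nonZero; >-nonZero⁻¹)
open import Data.Nat.Properties
  using (*-comm; +-comm; +-assoc; +-identityʳ; +-suc; *-monoʳ-≤; *-mono-≤; m≤n+m; +-monoˡ-≤; ≤-trans; module ≤-Reasoning)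
open import Data.Nat.DivMod using (_mod_; m≡m%n+[m/n]*n; [m+kn]%n≡m%n)
open import Data.Nat.Divisibility using (_∣_; divides; ∣⇒≤; *-monoˡ-∣; n∣m*n; m∣m*n; m%n≡0⇒n∣m; n∣m⇒m%n≡0)
open import Data.Nat.Coprimality using (Coprime; coprime-+; 1-coprimeTo; coprime-divisor)
import Data.Nat.Coprimality as Coprimality
open import Data.Fin using (Fin; zero; suc; toℕ; splitAt; join)
open import Data.Fin.Properties using (toℕ-fromℕ<; toℕ-injective; splitAt-join)
open import Data.Bool using (Bool; true; false)
open import Data.List using ([]; _∷_; replicate; foldl; length)
open import Data.List.Properties using (length-replicate; ∷-injectiveʳ)
open import Data.List.Relation.Unary.All using (All; _∷_)
open import Data.List.Relation.Unary.All.Properties using (++⁻ʳ; replicate⁺)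
open import Data.Sum using (_⊎_; inj₁; inj₂)
import Data.Sum as Sum
open import Data.Product using (∃; ∃-syntax; _×_; _,_)
open import Data.Empty using (⊥-elim)
open import Relation.Nullary using (¬_)
open import Function using (_∘_; id)
open import Function.Bundles using (_⇔_; mk⇔; Equivalence)
open import Relation.Binary.PropositionalEquality

isZero : ∀ {d} → Fin d → Bool
isZero zero    = true
isZero (suc _) = false

isZero⇒toℕ≡0 : ∀ {d} (i : Fin d) → isZero i ≡ true → toℕ i ≡ 0
isZero⇒toℕ≡0 zero _ = refl

toℕ≡0⇒isZero : ∀ {d} (i : Fin d) → toℕ i ≡ 0 → isZero i ≡ true
toℕ≡0⇒isZero zero _ = refl

module _ {d : ℕ} .{{_ : NonZero d}} where

  isZero-mod⇒∣ : ∀ m → isZero (m mod d) ≡ true → d ∣ m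
  isZero-mod⇒∣ m h = m%n≡0⇒n∣m m d (trans (sym (toℕ-fromℕ< _)) (isZero⇒toℕ≡0 _ h))

  ∣⇒isZero-mod : ∀ m → d ∣ m → isZero (m mod d) ≡ true
  ∣⇒isZero-mod m d∣m = toℕ≡0⇒isZero _ (trans (toℕ-fromℕ< _) (n∣m⇒m%n≡0 m d d∣m))

  inc : Fin d → Fin d
  inc i = suc (toℕ i) mod d

  inc-mod : ∀ m → inc (m mod d) ≡ suc m mod d
  inc-mod m = toℕ-injective (begin
      toℕ (suc (toℕ (m mod d)) mod d)   ≡⟨ toℕ-fromℕ< _ ⟩
      suc (toℕ (m mod d)) % d           ≡⟨ cong (λ r → suc r % d) (toℕ-fromℕ< _) ⟩
      suc (m % d) % d                   ≡⟨ [m+kn]%n≡m%n (suc (m % d)) (m / d) d ⟨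
      suc (m % d + m / d * d) % d       ≡⟨ cong (λ r → suc r % d) (m≡m%n+[m/n]*n m d) ⟨
      suc m % d                         ≡⟨ toℕ-fromℕ< _ ⟨
      toℕ (suc m mod d)                 ∎)
    where open ≡-Reasoning

coprime⇒*∣ : ∀ {m n o} → Coprime m n → m ∣ o → n ∣ o → m * n ∣ o
coprime⇒*∣ {m} {n} m⊥n m∣o (divides q refl) =
  *-monoˡ-∣ n (coprime-divisor m⊥n (subst (m ∣_) (*-comm q n) m∣o))

consecutive-coprime : ∀ n → Coprime n (suc n)
consecutive-coprime n = Coprimality.sym (subst (λ m → Coprime m n) (+-comm n 1) (coprime-+ (1-coprimeTo n)))

consecutive-common-multiple : ∀ n {t} .{{_ : NonZero t}} → n ∣ t → suc n ∣ t → n * suc n ≤ t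
consecutive-common-multiple n n∣t 1+n∣t = ∣⇒≤ (coprime⇒*∣ (consecutive-coprime n) n∣t 1+n∣t)

suffix-of-replicate : ∀ {k} {x : Fin k} t {v} → IsSuffix v (replicate t x) → All (_≡ x) v
suffix-of-replicate t (u , eq) = ++⁻ʳ u (subst (All _) eq (replicate⁺ t refl))

replicate-injectiveˡ : ∀ {A : Set} {x : A} s t → replicate s x ≡ replicate t x → s ≡ t
replicate-injectiveˡ zero    zero    _  = refl
replicate-injectiveˡ (suc s) (suc t) eq = cong suc (replicate-injectiveˡ s t (∷-injectiveʳ eq))

Witness-map : ∀ {k} {P Q : Word k → Set} → (∀ {w} → P w → Q w) → ∀ {v w} → Witness P v w → Witness Q v w
Witness-map f (Pv , Pw , v⊑w , v≢w) = f Pv , f Pw , v⊑w , v≢w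

module Encoding {k n : ℕ} {S : Set} (enc : S → Fin n) (dec : Fin n → S) (dec∘enc : ∀ s → dec (enc s) ≡ s)
                (s₀ : S) (step : S → Fin k → S) (final : S → Bool) where

  dfa : DFA k
  dfa = record { states = n ; start = enc s₀ ; δ = λ q x → enc (step (dec q) x) ; accept = final ∘ dec }

  δ*-enc : ∀ s w → δ* dfa (enc s) w ≡ enc (foldl step s w)
  δ*-enc s []      = refl
  δ*-enc s (x ∷ w) rewrite dec∘enc s = δ*-enc (step s x) w

  accepts⇔ : ∀ w → Accepts dfa w ⇔ (final (foldl step s₀ w) ≡ true)
  accepts⇔ w rewrite δ*-enc s₀ w | dec∘enc (foldl step s₀ w) = mk⇔ id id

module Runs {k : ℕ} {S : Set} (step : S → Fin (suc k) → S) (final : S → Bool) (sink : S)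
            (sink-absorbs : ∀ x → step sink x ≡ sink) (sink-rejects : final sink ≡ false) where

  run : S → Word (suc k) → S
  run = foldl step

  Accepting : S → Word (suc k) → Set
  Accepting s w = final (run s w) ≡ true

  sink-rejects-all : ∀ w → ¬ Accepting sink w
  sink-rejects-all []      h with () ← trans (sym sink-rejects) h
  sink-rejects-all (x ∷ w) rewrite sink-absorbs x = sink-rejects-all w

  module Counter {d : ℕ} .{{_ : NonZero d}} (K : Fin d → S)
                 (K-tick : ∀ i → step (K i) zero ≡ K (inc i))
                 (K-halt : ∀ i x → step (K i) (suc x) ≡ sink)
                 (K-final : ∀ i → final (K i) ≡ isZero i) where

    run-ticks : ∀ m t → run (K (m mod d)) (replicate t zero) ≡ K ((m + t) mod d)
    run-ticks m zero    rewrite +-identityʳ m = refl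
    run-ticks m (suc t) rewrite K-tick (m mod d) | inc-mod m | +-suc m t = run-ticks (suc m) t

    accepting-ticks : ∀ m t → d ∣ m + t → Accepting (K (m mod d)) (replicate t zero)
    accepting-ticks m t d∣m+t rewrite run-ticks m t | K-final ((m + t) mod d) = ∣⇒isZero-mod (m + t) d∣m+t

    accepting⇒ticks : ∀ m r → Accepting (K (m mod d)) r → ∃ λ t → r ≡ replicate t zero × d ∣ m + t
    accepting⇒ticks m [] h rewrite K-final (m mod d) =
      0 , refl , subst (d ∣_) (sym (+-identityʳ m)) (isZero-mod⇒∣ m h)
    accepting⇒ticks m (zero ∷ r) h rewrite K-tick (m mod d) | inc-mod m with accepting⇒ticks (suc m) r h
    ... | t , refl , d∣1+m+t = suc t , refl , subst (d ∣_) (sym (+-suc m t)) d∣1+m+t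
    accepting⇒ticks m (suc x ∷ r) h rewrite K-halt (m mod d) x = ⊥-elim (sink-rejects-all r h)

pattern a = zero
pattern b = suc zero
pattern c = suc (suc zero)

module Construction (n : ℕ) .{{_ : NonZero n}} where

  State : Set
  State = Fin 4 ⊎ (Fin (suc n) ⊎ Fin n)

  pattern s₀      = inj₁ zero
  pattern after-b = inj₁ (suc zero)
  pattern after-c = inj₁ (suc (suc zero))
  pattern dead    = inj₁ (suc (suc (suc zero)))
  pattern V i     = inj₂ (inj₁ i)
  pattern W j     = inj₂ (inj₂ j)

  step : State → Fin 3 → State
  step s₀      b = after-b
  step s₀      c = after-c
  step after-b c = W (0 mod n)
  step after-c a = V (1 mod suc n)
  step (V i)   a = V (inc i)
  step (W j)   a = W (inc j)
  step _       _ = dead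

  final : State → Bool
  final (V i) = isZero i
  final (W j) = isZero j
  final _     = false

  open Runs step final dead (λ _ → refl) refl
  module V = Counter V (λ _ → refl) (λ _ _ → refl) (λ _ → refl)
  module W = Counter W (λ _ → refl) (λ _ _ → refl) (λ _ → refl)

  data L : Word 3 → Set where
    c-aˢ  : ∀ {s} → 1 ≤ s → suc n ∣ s → L (c ∷ replicate s a)
    bc-aᵗ : ∀ {t} → n ∣ t → L (b ∷ c ∷ replicate t a)

  L⇒accepting : ∀ {w} → L w → Accepting s₀ w
  L⇒accepting (c-aˢ {suc s} _ 1+n∣s) = V.accepting-ticks 1 s 1+n∣s
  L⇒accepting (bc-aᵗ {t} n∣t)        = W.accepting-ticks 0 t n∣t

  accepting⇒L : ∀ w → Accepting s₀ w → L w
  accepting⇒L (a ∷ w)     h = ⊥-elim (sink-rejects-all w h)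
  accepting⇒L (b ∷ a ∷ w) h = ⊥-elim (sink-rejects-all w h)
  accepting⇒L (b ∷ b ∷ w) h = ⊥-elim (sink-rejects-all w h)
  accepting⇒L (b ∷ c ∷ w) h with W.accepting⇒ticks 0 w h
  ... | t , refl , n∣t = bc-aᵗ n∣t
  accepting⇒L (c ∷ a ∷ w) h with V.accepting⇒ticks 1 w h
  ... | s , refl , 1+n∣1+s = c-aˢ (s≤s z≤n) 1+n∣1+s
  accepting⇒L (c ∷ b ∷ w) h = ⊥-elim (sink-rejects-all w h)
  accepting⇒L (c ∷ c ∷ w) h = ⊥-elim (sink-rejects-all w h)

  ¬All≡a : ∀ {w} → L w → ¬ All (_≡ a) w
  ¬All≡a (c-aˢ _ _) (() ∷ _)
  ¬All≡a (bc-aᵗ _)  (() ∷ _)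

  witness-length : ∀ {v w} → Witness L v w → n * suc n ≤ length w
  witness-length (_ , c-aˢ _ _ , ([] , refl) , v≢w) = ⊥-elim (v≢w refl)
  witness-length (Lv , c-aˢ {s} _ _ , (_ ∷ u , eq) , _) =
    ⊥-elim (¬All≡a Lv (suffix-of-replicate s (u , ∷-injectiveʳ eq)))
  witness-length (_ , bc-aᵗ _ , ([] , refl) , v≢w) = ⊥-elim (v≢w refl)
  witness-length (Lv , bc-aᵗ {t} _ , (_ ∷ _ ∷ u , eq) , _) =
    ⊥-elim (¬All≡a Lv (suffix-of-replicate t (u , ∷-injectiveʳ (∷-injectiveʳ eq))))
  witness-length (bc-aᵗ _ , bc-aᵗ _ , (_ ∷ [] , ()) , _)
  witness-length (c-aˢ {s} 1≤s 1+n∣s , bc-aᵗ {t} n∣t , (_ ∷ [] , eq) , _)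
    with refl ← replicate-injectiveˡ t s (∷-injectiveʳ (∷-injectiveʳ eq)) = begin
      n * suc n                       ≤⟨ consecutive-common-multiple n {{>-nonZero 1≤s}} n∣t 1+n∣s ⟩
      t                               ≡⟨ length-replicate t ⟨
      length (replicate t a)          ≤⟨ m≤n+m _ 2 ⟩
      length (b ∷ c ∷ replicate t a)  ∎
    where open ≤-Reasoning

  enc : State → Fin (4 + (suc n + n))
  enc = join 4 (suc n + n) ∘ Sum.map₂ (join (suc n) n)

  dec : Fin (4 + (suc n + n)) → State
  dec = Sum.map₂ (splitAt (suc n)) ∘ splitAt 4

  dec∘enc : ∀ s → dec (enc s) ≡ s
  dec∘enc (inj₁ x) rewrite splitAt-join 4 (suc n + n) (inj₁ x) = refl
  dec∘enc (inj₂ y) rewrite splitAt-join 4 (suc n + n) (inj₂ (join (suc n) n y))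
                         | splitAt-join (suc n) n y = refl

  open Encoding enc dec dec∘enc s₀ step final using (dfa; accepts⇔) public

  L⇒Accepts : ∀ {w} → L w → Accepts dfa w
  L⇒Accepts {w} = Equivalence.from (accepts⇔ w) ∘ L⇒accepting

  Accepts⇒L : ∀ {w} → Accepts dfa w → L w
  Accepts⇒L {w} = accepting⇒L w ∘ Equivalence.to (accepts⇔ w)

  states≤7n : states dfa ≤ 7 * n
  states≤7n = begin
      5 + (n + n)      ≤⟨ +-monoˡ-≤ (n + n) (*-monoʳ-≤ 5 (>-nonZero⁻¹ n)) ⟩
      5 * n + (n + n)  ≡⟨ +-comm (5 * n) (n + n) ⟩
      n + n + 5 * n    ≡⟨ +-assoc n n (5 * n) ⟩
      7 * n            ∎
    where open ≤-Reasoning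

  shortest-witness : Witness L (c ∷ replicate (n * suc n) a) (b ∷ c ∷ replicate (n * suc n) a)
  shortest-witness =
    c-aˢ (*-mono-≤ (>-nonZero⁻¹ n) (s≤s z≤n)) (n∣m*n n) , bc-aᵗ (m∣m*n (suc n)) , (b ∷ [] , refl) , λ ()

  not-suffix-free : ¬ SuffixFree (Accepts dfa)
  not-suffix-free suffix-free = suffix-free _ _ (Witness-map {P = L} L⇒Accepts shortest-witness)

  witness-bound : ∀ {v w} → Witness (Accepts dfa) v w → n * n ≤ length w
  witness-bound wit = ≤-trans (*-monoʳ-≤ n (m≤n+m n 1)) (witness-length (Witness-map Accepts⇒L wit))

theorem14 : ∃[ k ] ∃[ p ] ∃[ q ] ∃[ C ] (p ≥ 1 × q ≥ 1 ×
    (∀ (n : ℕ) → n ≥ 1 → ∃ λ (A : DFA k) →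
    states A ≤ C * n
    × ¬ SuffixFree (Accepts A)
    × (∀ (v w : Word k) → Witness (Accepts A) v w → p * (n * n) ≤ q * length w)))
theorem14 = 3 , 1 , 1 , 7 , s≤s z≤n , s≤s z≤n , family
  where
    family : ∀ n → n ≥ 1 → ∃ λ (A : DFA 3) → states A ≤ 7 * n × ¬ SuffixFree (Accepts A)
             × (∀ v w → Witness (Accepts A) v w → 1 * (n * n) ≤ 1 * length w)
    family n n≥1 = dfa , states≤7n , not-suffix-free , λ _ _ → *-monoʳ-≤ 1 ∘ witness-bound
      where
        instance _ = >-nonZero n≥1
        open Construction n
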